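{- (1) $\mathbf{K_N^{Horn,\Box}}\prec\mathbf{K_N^{Horn}}$; (2) $\mathbf{K_N^{core,\Box}}\prec\mathbf{K_N^{core}}$.
   Context: Fix a finite set $\tau$ of modality labels and a countable set $\mathcal P$ of propositional letters. Formulas of $\mathbf{K_N}$ are generated by $\varphi ::= \top \mid p \mid \neg\varphi \mid \varphi\vee\varphi \mid \Diamond_\alpha\varphi \mid \Box_\alpha\varphi$; $\wedge,\rightarrow$ are abbreviations, $\bot=\neg\top$. Models $M=(\mathcal F,V)$ with frame $\mathcal F=(W,\{R_\alpha\}_{\alpha\in\tau})$, $W\neq\emptyset$, $R_\alpha\subseteq W\times W$, $V:W\to2^{\mathcal P}$, standard Kripke semantics. Positive literals: $\lambda ::= \top \mid p \mid \Diamond_\alpha\lambda \mid \Box_\alpha\lambda$. Clausal form: $\varphi ::= \lambda \mid \neg\lambda \mid \nabla(\neg\lambda_1\vee\dots\vee\neg\lambda_n\vee\lambda_{n+1}\vee\dots\vee\lambda_{n+m}) \mid \varphi\wedge\varphi$, with positive literals $\lambda,\lambda_i$ and $\nabla$ a finite (possibly empty) sequence of boxes. $\mathbf{K_N^{Horn}}$: every clause has $m\le1$; $\mathbf{K_N^{Krom}}$: $n+m\le2$; $\mathbf{K_N^{core}}$: both. For $X\in\{\mathrm{Horn},\mathrm{core}\}$, $\mathbf{K_N^{X,\Box}}$ is the subfragment of $\mathbf{K_N^{X}}$ in which positive literals contain no diamonds ($\lambda::=\top\mid p\mid\Box_\alpha\lambda$; prefixes $\nabla$ unchanged). Strong expressivity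 (over all Kripke frames): for a model $M=(\mathcal F,V)$ over $\mathcal P$ and $\mathcal P'\supseteq\mathcal P$, an extension of $M$ is a model $(\mathcal F,V')$ over $\mathcal P'$ with $V'$ agreeing with $V$ on $\mathcal P$. $\mathbf L\preceq\mathbf L'$ if there is an effective translation taking each $\mathbf L$-formula $\varphi$ over $\mathcal P$ to an $\mathbf L'$-formula $\varphi'$ over some alphabet $\mathcal P'\supseteq\mathcal P$ (adding finitely many new letters) such that for every model $M$ over $\mathcal P$ and world $w$: $M,w\Vdash\varphi$ iff some extension $M'$ of $M$ to $\mathcal P'$ satisfies $M',w\Vdash\varphi'$. $\mathbf L\equiv\mathbf L'$ means $\mathbf L\preceq\mathbf L'$ and $\mathbf L'\preceq\mathbf L$; $\mathbf L\prec\mathbf L'$ means $\mathbf L\preceq\mathbf L'$ and not $\mathbf L\equiv\mathbf L'$. -}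

module Defs where

open import Data.Nat using (ℕ; _+_; _≤_)
open import Data.Fin using (Fin)
open import Data.Bool using (Bool; true; false)
open import Data.List using (List; []; _∷_; map; _++_; length)
open import Data.List.Relation.Unary.All using (All)
open import Data.Product using (Σ; _×_; ∃)
open import Data.Sum using (_⊎_; inj₁)
open import Data.Unit using (⊤)
open import Relation.Nullary using (¬_)
open import Relation.Binary.PropositionalEquality using (_≡_)

data Fm (N : ℕ) (A : Set) : Set where
  top : Fm N A
  var : A → Fm N A
  neg : Fm N A → Fm N A
  or  : Fm N A → Fm N A → Fm N A
  dia : Fin N → Fm N A → Fm N A
  box : Fin N → Fm N A → Fm N A

module _ {N : ℕ} {A : Set} where

  bot : Fm N A
  bot = neg top

  and : Fm N A → Fm N A → Fm N A
  and φ ψ = neg (or (neg φ) (neg ψ))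

  disj : List (Fm N A) → Fm N A
  disj []           = bot
  disj (φ ∷ [])     = φ
  disj (φ ∷ ψ ∷ ψs) = or φ (disj (ψ ∷ ψs))

  clause : List (Fm N A) → List (Fm N A) → Fm N A
  clause ns ps = disj (map neg ns ++ ps)

  boxes : List (Fin N) → Fm N A → Fm N A
  boxes []       φ = φ
  boxes (a ∷ as) φ = box a (boxes as φ)

  -- Positive literals.  d = true: λ ::= ⊤ | p | ◇λ | □λ ;
  -- d = false (box-only variant): λ ::= ⊤ | p | □λ.
  data PosLit : Bool → Fm N A → Set where
    top : ∀ {d} → PosLit d top
    var : ∀ {d} p → PosLit d (var p)
    dia : ∀ a {l} → PosLit true l → PosLit true (dia a l)
    box : ∀ {d} a {l} → PosLit d l → PosLit d (box a l)

  data Clausal (d : Bool) (ok : ℕ → ℕ → Set) : Fm N A → Set where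
    lit  : ∀ {l} → PosLit d l → Clausal d ok l
    nlit : ∀ {l} → PosLit d l → Clausal d ok (neg l)
    cls  : (∇ : List (Fin N)) (ns ps : List (Fm N A)) →
           All (PosLit d) ns → All (PosLit d) ps →
           ok (length ns) (length ps) →
           Clausal d ok (boxes ∇ (clause ns ps))
    conj : ∀ {φ ψ} → Clausal d ok φ → Clausal d ok ψ → Clausal d ok (and φ ψ)

Lang : ℕ → Set₁
Lang N = (A : Set) → Fm N A → Set

HornOK KromOK coreOK : ℕ → ℕ → Set
HornOK n m = m ≤ 1
KromOK n m = n + m ≤ 2
coreOK n m = (m ≤ 1) × (n + m ≤ 2)

KHorn KHorn□ Kcore Kcore□ : (N : ℕ) → Lang N
KHorn  N A = Clausal true  HornOK
KHorn□ N A = Clausal false HornOK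
Kcore  N A = Clausal true  coreOK
Kcore□ N A = Clausal false coreOK

record Frame (N : ℕ) : Set₁ where
  field
    W : Set
    R : Fin N → W → W → Set
open Frame public

Sat : ∀ {N A} (F : Frame N) → (W F → A → Bool) → W F → Fm N A → Set
Sat F V w top       = ⊤
Sat F V w (var p)   = V w p ≡ true
Sat F V w (neg φ)   = ¬ Sat F V w φ
Sat F V w (or φ ψ)  = Sat F V w φ ⊎ Sat F V w ψ
Sat F V w (dia a φ) = Σ (W F) λ v → R F a w v × Sat F V v φ
Sat F V w (box a φ) = (v : W F) → R F a w v → Sat F V v φ

-- Original letters P = ℕ; the target alphabet is
-- P' = ℕ ⊎ ℕ with the new letters tagged inj₂ (a formula uses only
-- finitely many of them).

_⪯_ : ∀ {N} → Lang N → Lang N → Set₁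
_⪯_ {N} L L' =
  Σ ((φ : Fm N ℕ) → L ℕ φ → Fm N (ℕ ⊎ ℕ)) λ t →
    ((φ : Fm N ℕ) (h : L ℕ φ) → L' (ℕ ⊎ ℕ) (t φ h)) ×
    ((φ : Fm N ℕ) (h : L ℕ φ) (F : Frame N) (V : W F → ℕ → Bool) (w : W F) →
       (Sat F V w φ →
          Σ (W F → ℕ ⊎ ℕ → Bool) λ V' →
            ((v : W F) (p : ℕ) → V' v (inj₁ p) ≡ V v p) × Sat F V' w (t φ h))
     × ((Σ (W F → ℕ ⊎ ℕ → Bool) λ V' →
            ((v : W F) (p : ℕ) → V' v (inj₁ p) ≡ V v p) × Sat F V' w (t φ h))
          → Sat F V w φ))

_≡ₑ_ : ∀ {N} → Lang N → Lang N → Set₁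
L ≡ₑ L' = (L ⪯ L') × (L' ⪯ L)

_≺_ : ∀ {N} → Lang N → Lang N → Set₁
L ≺ L' = (L ⪯ L') × ¬ (L ≡ₑ L')

-- Inclusion: a box-only clausal formula is already a clausal formula, once
-- its letters are tagged as old ones.
-- Strictness: box-only Horn formulas are preserved under intersecting two
-- valuations (their positive literals are conjunctive and each clause has at
-- most one positive literal), and a translation with fresh letters transfers
-- this property back to the source language.  But ◇p is not preserved: in the
-- frame w → u, w → v, make p true only at u, resp. only at v.
module Submission where

open import Defs
open import Data.Nat using (ℕ; _≤_; suc; s≤s)
open import Data.Product using (_×_; _,_; proj₁; proj₂)
open import Data.Fin using (Fin)
open import Data.Bool using (Bool; true; false; _∧_)
open import Data.Bool.Properties using (∧-conicalˡ; ∧-conicalʳ)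
open import Data.List using (List; []; _∷_; map; _++_; length)
open import Data.List.Properties using (map-++; length-map)
open import Data.List.Relation.Unary.All using (All; []; _∷_)
open import Data.List.Relation.Unary.Any using (Any; here; there; toSum; fromSum)
open import Data.List.Relation.Unary.Any.Properties using (map⁺; map⁻; ++⁺ˡ; ++⁺ʳ; ++⁻; singleton⁻)
open import Data.Sum using (_⊎_; inj₁; inj₂; [_,_]′)
import Data.Sum as Sum
open import Data.Unit using (tt)
open import Data.Empty using (⊥-elim)
open import Function using (id; const; _∘_)
open import Function.Bundles using (_⇔_; mk⇔; Equivalence)
open import Relation.Nullary using (¬_)
open import Relation.Binary.PropositionalEquality using (_≡_; refl; sym; trans; cong; cong₂; subst; subst₂; module ≡-Reasoning)

open Equivalence using (to; from)

Any-zipAll : ∀ {X : Set} {P Q R : X → Set} {xs} →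
             (∀ {x} → P x → Q x → R x) → All P xs → Any Q xs → Any R xs
Any-zipAll f (px ∷ _)   (here qx) = here (f px qx)
Any-zipAll f (_  ∷ pxs) (there q) = there (Any-zipAll f pxs q)

ren : ∀ {N A B} → (A → B) → Fm N A → Fm N B
ren f top       = top
ren f (var p)   = var (f p)
ren f (neg φ)   = neg (ren f φ)
ren f (or φ ψ)  = or (ren f φ) (ren f ψ)
ren f (dia a φ) = dia a (ren f φ)
ren f (box a φ) = box a (ren f φ)

module _ {N : ℕ} {A B : Set} (f : A → B) where

  ren-boxes : (∇ : List (Fin N)) (φ : Fm N A) → ren f (boxes ∇ φ) ≡ boxes ∇ (ren f φ)
  ren-boxes []      φ = refl
  ren-boxes (a ∷ ∇) φ = cong (box a) (ren-boxes ∇ φ)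

  ren-disj : (φs : List (Fm N A)) → ren f (disj φs) ≡ disj (map (ren f) φs)
  ren-disj []           = refl
  ren-disj (φ ∷ [])     = refl
  ren-disj (φ ∷ ψ ∷ ψs) = cong (or (ren f φ)) (ren-disj (ψ ∷ ψs))

  ren-map-neg : (φs : List (Fm N A)) → map (ren f) (map neg φs) ≡ map neg (map (ren f) φs)
  ren-map-neg []       = refl
  ren-map-neg (φ ∷ φs) = cong (neg (ren f φ) ∷_) (ren-map-neg φs)

  ren-clause : (ns ps : List (Fm N A)) → ren f (clause ns ps) ≡ clause (map (ren f) ns) (map (ren f) ps)
  ren-clause ns ps = begin
    ren f (disj (map neg ns ++ ps))                   ≡⟨ ren-disj (map neg ns ++ ps) ⟩
    disj (map (ren f) (map neg ns ++ ps))             ≡⟨ cong disj (map-++ (ren f) (map neg ns) ps) ⟩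
    disj (map (ren f) (map neg ns) ++ map (ren f) ps) ≡⟨ cong (λ xs → disj (xs ++ map (ren f) ps)) (ren-map-neg ns) ⟩
    disj (map neg (map (ren f) ns) ++ map (ren f) ps) ∎
    where open ≡-Reasoning

  PosLit□-ren : ∀ {d} {l : Fm N A} → PosLit false l → PosLit d (ren f l)
  PosLit□-ren top       = top
  PosLit□-ren (var p)   = var (f p)
  PosLit□-ren (box a h) = box a (PosLit□-ren h)

  All-PosLit□-ren : ∀ {d} {ls : List (Fm N A)} → All (PosLit false) ls → All (PosLit d) (map (ren f) ls)
  All-PosLit□-ren []       = []
  All-PosLit□-ren (h ∷ hs) = PosLit□-ren h ∷ All-PosLit□-ren hs

  Clausal□-ren : ∀ {d ok} {φ : Fm N A} → Clausal false ok φ → Clausal d ok (ren f φ)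
  Clausal□-ren (lit h)  = lit (PosLit□-ren h)
  Clausal□-ren (nlit h) = nlit (PosLit□-ren h)
  Clausal□-ren {d} {ok} (cls ∇ ns ps hn hp o) =
    subst (Clausal d ok) (sym (trans (ren-boxes ∇ (clause ns ps)) (cong (boxes ∇) (ren-clause ns ps))))
      (cls ∇ (map (ren f) ns) (map (ren f) ps) (All-PosLit□-ren hn) (All-PosLit□-ren hp)
        (subst₂ ok (sym (length-map (ren f) ns)) (sym (length-map (ren f) ps)) o))
  Clausal□-ren (conj h k) = conj (Clausal□-ren h) (Clausal□-ren k)

  Sat-ren : (F : Frame N) {V′ : W F → B → Bool} {V : W F → A → Bool} →
            (∀ v p → V′ v (f p) ≡ V v p) → ∀ φ w → Sat F V′ w (ren f φ) ⇔ Sat F V w φ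
  Sat-ren F agree top     w = mk⇔ id id
  Sat-ren F agree (var p) w = mk⇔ (trans (sym (agree w p))) (trans (agree w p))
  Sat-ren F agree (neg φ) w = mk⇔ (λ ¬s → ¬s ∘ from ih) (λ ¬s → ¬s ∘ to ih)
    where ih = Sat-ren F agree φ w
  Sat-ren F agree (or φ ψ) w = mk⇔ (Sum.map (to ihφ) (to ihψ)) (Sum.map (from ihφ) (from ihψ))
    where ihφ = Sat-ren F agree φ w
          ihψ = Sat-ren F agree ψ w
  Sat-ren F agree (dia a φ) w =
    mk⇔ (λ (v , r , s) → v , r , to (Sat-ren F agree φ v) s)
        (λ (v , r , s) → v , r , from (Sat-ren F agree φ v) s)
  Sat-ren F agree (box a φ) w =
    mk⇔ (λ s v r → to (Sat-ren F agree φ v) (s v r))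
        (λ s v r → from (Sat-ren F agree φ v) (s v r))

ClausalLang : ∀ {N} → Bool → (ℕ → ℕ → Set) → Lang N
ClausalLang d ok A = Clausal d ok

Clausal□⪯Clausal : ∀ {N} (ok : ℕ → ℕ → Set) → ClausalLang {N} false ok ⪯ ClausalLang true ok
Clausal□⪯Clausal ok =
  (λ φ _ → ren inj₁ φ) , (λ _ → Clausal□-ren inj₁) ,
  λ φ _ F V w →
    (λ s → extend V , (λ _ _ → refl) , from (Sat-ren inj₁ F (λ _ _ → refl) φ w) s) ,
    (λ (V′ , agree , s) → to (Sat-ren inj₁ F agree φ w) s)
  where
  extend : ∀ {X : Set} → (X → ℕ → Bool) → X → ℕ ⊎ ℕ → Bool
  extend V v = [ V v , const false ]′

_∩_ : ∀ {X A : Set} → (X → A → Bool) → (X → A → Bool) → X → A → Bool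
(V₁ ∩ V₂) v p = V₁ v p ∧ V₂ v p

∩-Stable : ∀ {N A} → Fm N A → Set₁
∩-Stable {N} {A} φ =
  (F : Frame N) (V₁ V₂ : W F → A → Bool) (w : W F) →
  Sat F V₁ w φ → Sat F V₂ w φ → Sat F (V₁ ∩ V₂) w φ

⪯-reflects-∩-Stable : ∀ {N} {L L′ : Lang N} → L ⪯ L′ →
                      (∀ φ → L′ (ℕ ⊎ ℕ) φ → ∩-Stable φ) → ∀ φ → L ℕ φ → ∩-Stable φ
⪯-reflects-∩-Stable (t , t-in-L′ , t-sound) stable φ h F V₁ V₂ w s₁ s₂ =
  let (V₁′ , agree₁ , t₁) = proj₁ (t-sound φ h F V₁ w) s₁
      (V₂′ , agree₂ , t₂) = proj₁ (t-sound φ h F V₂ w) s₂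
  in proj₂ (t-sound φ h F (V₁ ∩ V₂) w)
       ( V₁′ ∩ V₂′
       , (λ v p → cong₂ _∧_ (agree₁ v p) (agree₂ v p))
       , stable (t φ h) (t-in-L′ φ h) F V₁′ V₂′ w t₁ t₂)

module _ {N : ℕ} {A : Set} where

  boxes-∩-Stable : {φ : Fm N A} → ∩-Stable φ → ∀ ∇ → ∩-Stable (boxes ∇ φ)
  boxes-∩-Stable stable []      = stable
  boxes-∩-Stable stable (a ∷ ∇) F V₁ V₂ w s₁ s₂ v r =
    boxes-∩-Stable stable ∇ F V₁ V₂ v (s₁ v r) (s₂ v r)

  and-∩-Stable : {φ ψ : Fm N A} → ∩-Stable φ → ∩-Stable ψ → ∩-Stable (and φ ψ)
  and-∩-Stable stφ stψ F V₁ V₂ w s₁ s₂ (inj₁ ¬φ) =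
    s₁ (inj₁ λ a₁ → s₂ (inj₁ λ a₂ → ¬φ (stφ F V₁ V₂ w a₁ a₂)))
  and-∩-Stable stφ stψ F V₁ V₂ w s₁ s₂ (inj₂ ¬ψ) =
    s₁ (inj₂ λ a₁ → s₂ (inj₂ λ a₂ → ¬ψ (stψ F V₁ V₂ w a₁ a₂)))

  module _ (F : Frame N) where

    Sat-disj : ∀ {V : W F → A → Bool} w (φs : List (Fm N A)) →
               Sat F V w (disj φs) ⇔ Any (Sat F V w) φs
    Sat-disj w []           = mk⇔ (λ s → ⊥-elim (s tt)) λ ()
    Sat-disj w (φ ∷ [])     = mk⇔ here singleton⁻
    Sat-disj {V} w (φ ∷ ψs@(_ ∷ _)) =
      mk⇔ (fromSum ∘ Sum.map₂ (to (Sat-disj {V} w ψs)))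
          (Sum.map₂ (from (Sat-disj {V} w ψs)) ∘ toSum)

    Sat-clause : ∀ {V : W F → A → Bool} w (ns ps : List (Fm N A)) →
                 Sat F V w (clause ns ps) ⇔ (Any (λ l → ¬ Sat F V w l) ns ⊎ Any (Sat F V w) ps)
    Sat-clause w ns ps =
      mk⇔ (Sum.map₁ map⁻ ∘ ++⁻ (map neg ns) ∘ to (Sat-disj w (map neg ns ++ ps)))
          (from (Sat-disj w (map neg ns ++ ps)) ∘ [ ++⁺ˡ ∘ map⁺ , ++⁺ʳ (map neg ns) ]′)

    module _ (V₁ V₂ : W F → A → Bool) where

      PosLit□-∩ : ∀ {l} → PosLit false l → ∀ w →
                  Sat F (V₁ ∩ V₂) w l ⇔ (Sat F V₁ w l × Sat F V₂ w l)
      PosLit□-∩ top       w = mk⇔ (const (tt , tt)) (const tt)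
      PosLit□-∩ (var p)   w =
        mk⇔ (λ e → ∧-conicalˡ _ _ e , ∧-conicalʳ _ _ e) (λ (e₁ , e₂) → cong₂ _∧_ e₁ e₂)
      PosLit□-∩ (box a h) w =
        mk⇔ (λ s → (λ v r → proj₁ (to (PosLit□-∩ h v) (s v r))) ,
                   (λ v r → proj₂ (to (PosLit□-∩ h v) (s v r))))
            (λ (s₁ , s₂) v r → from (PosLit□-∩ h v) (s₁ v r , s₂ v r))

      clause□-∩ : ∀ w (ns ps : List (Fm N A)) → All (PosLit false) ns → All (PosLit false) ps →
                  length ps ≤ 1 → Sat F V₁ w (clause ns ps) → Sat F V₂ w (clause ns ps) →
                  Sat F (V₁ ∩ V₂) w (clause ns ps)
      clause□-∩ w ns ps hn hp |ps|≤1 s₁ s₂ =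
        from (Sat-clause w ns ps) (combine (to (Sat-clause w ns ps) s₁) (to (Sat-clause w ns ps) s₂))
        where
        verified : ∀ {qs} → All (PosLit false) qs → length qs ≤ 1 →
                   Any (Sat F V₁ w) qs → Any (Sat F V₂ w) qs → Any (Sat F (V₁ ∩ V₂) w) qs
        verified (h ∷ [])    _        a₁ a₂ = here (from (PosLit□-∩ h w) (singleton⁻ a₁ , singleton⁻ a₂))
        verified (_ ∷ _ ∷ _) (s≤s ()) _  _
        combine : Any (λ l → ¬ Sat F V₁ w l) ns ⊎ Any (Sat F V₁ w) ps →
                  Any (λ l → ¬ Sat F V₂ w l) ns ⊎ Any (Sat F V₂ w) ps →
                  Any (λ l → ¬ Sat F (V₁ ∩ V₂) w l) ns ⊎ Any (Sat F (V₁ ∩ V₂) w) ps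
        combine (inj₁ r₁) _         = inj₁ (Any-zipAll (λ h ¬s → ¬s ∘ proj₁ ∘ to (PosLit□-∩ h w)) hn r₁)
        combine _         (inj₁ r₂) = inj₁ (Any-zipAll (λ h ¬s → ¬s ∘ proj₂ ∘ to (PosLit□-∩ h w)) hn r₂)
        combine (inj₂ a₁) (inj₂ a₂) = inj₂ (verified hp |ps|≤1 a₁ a₂)

  Clausal□-∩-Stable : ∀ {ok} → (∀ {n m} → ok n m → m ≤ 1) →
                      {φ : Fm N A} → Clausal false ok φ → ∩-Stable φ
  Clausal□-∩-Stable horn (lit h)  F V₁ V₂ w s₁ s₂ = from (PosLit□-∩ F V₁ V₂ h w) (s₁ , s₂)
  Clausal□-∩-Stable horn (nlit h) F V₁ V₂ w s₁ _  = s₁ ∘ proj₁ ∘ to (PosLit□-∩ F V₁ V₂ h w)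
  Clausal□-∩-Stable horn (cls ∇ ns ps hn hp o) =
    boxes-∩-Stable (λ F V₁ V₂ w → clause□-∩ F V₁ V₂ w ns ps hn hp (horn o)) ∇
  Clausal□-∩-Stable horn (conj h k) =
    and-∩-Stable (Clausal□-∩-Stable horn h) (Clausal□-∩-Stable horn k)

data Fork : Set where
  root left right : Fork

data _↝_ : Fork → Fork → Set where
  root↝left  : root ↝ left
  root↝right : root ↝ right

fork : (N : ℕ) → Frame N
fork N = record { W = Fork ; R = λ _ → _↝_ }

trueOnlyAt : {A : Set} → Fork → Fork → A → Bool
trueOnlyAt left  left  _ = true
trueOnlyAt right right _ = true
trueOnlyAt _     _     _ = false

◇-not-∩-Stable : ∀ {N A} (a : Fin N) (p : A) → ¬ ∩-Stable (dia a (var p))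
◇-not-∩-Stable {N} a p stable
  with stable (fork N) (trueOnlyAt left) (trueOnlyAt right) root
              (left , root↝left , refl) (right , root↝right , refl)
... | left  , _ , ()
... | right , _ , ()

Clausal⋠Clausal□ : ∀ {N} {ok : ℕ → ℕ → Set} → (∀ {n m} → ok n m → m ≤ 1) → Fin N →
                   ¬ (ClausalLang {N} true ok ⪯ ClausalLang false ok)
Clausal⋠Clausal□ {N} {ok} horn a embedding =
  ◇-not-∩-Stable a 0
    (⪯-reflects-∩-Stable {L = ClausalLang true ok} {L′ = ClausalLang false ok} embedding
      (λ _ → Clausal□-∩-Stable horn) (dia a (var 0)) (lit (dia a (var 0))))

theorem3 : (N : ℕ) → 1 ≤ N → (KHorn□ N ≺ KHorn N) × (Kcore□ N ≺ Kcore N)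
theorem3 (suc n) _ =
  (Clausal□⪯Clausal HornOK , Clausal⋠Clausal□ id Fin.zero ∘ proj₂) ,
  (Clausal□⪯Clausal coreOK , Clausal⋠Clausal□ proj₁ Fin.zero ∘ proj₂)
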